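{- Let $\lambda$ be a partition and let $\mu$ be a $\lambda$-survivor. Then: (a) for every $i\ge2$, if the rightmost square of row $i$ of $\lambda$ is not contained in $\mu$, then the rightmost square of row $i-1$ of $\lambda$ is not contained in $\mu$; (b) for every $i\ge2$, if the bottommost square of column $i$ of $\mu$ is not contained in $\lambda$, then the bottommost square of column $i-1$ of $\mu$ is not contained in $\lambda$.
   Context: Partitions are identified with their (English-convention, left-justified) diagrams, with $\lambda_i$ squares in row $i$. For partitions $\lambda\supseteq\nu$, $\lambda-\nu$ is the skew diagram of squares of $\lambda$ not in $\nu$; it is a horizontal strip if it has at most one square in each column and a vertical strip if it has at most one square in each row. $\mathcal{R}_{\lambda,\mu}$ is the set of partitions $\nu$ such that $\lambda-\nu$ is a vertical strip and $\mu-\nu$ is a horizontal strip. A $\lambda$-ambiguous square of $\mu$ is a square contained in both $\lambda$ and $\mu$ that is the rightmost square in its row of $\lambda$ and the bottommost square in its column of $\mu$. A partition $\mu$ is a $\lambda$-survivor if $\mathcal{R}_{\lambda,\mu}$ is nonempty and $\mu$ has no $\lambda$-ambiguous squares. -}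

module Defs where

open import Data.Nat using (ℕ; zero; suc; _≤_; _<_; _≥_; _∸_)
open import Data.List using (List; []; _∷_)
open import Data.List.Relation.Unary.All using (All)
open import Data.List.Relation.Unary.Linked using (Linked)
open import Data.Product using (_×_; _,_; proj₁; proj₂; Σ; ∃)
open import Relation.Nullary using (¬_)
open import Relation.Binary.PropositionalEquality using (_≡_)

record Partition : Set where
  constructor mkPartition
  field
    parts      : List ℕ
    decreasing : Linked _≥_ parts
    positive   : All (0 <_) parts
open Partition public

-- 1-indexed row lengths: rowList xs i = λ_i for i ≥ 1 (0 beyond the length, and 0 at i = 0).
rowList : List ℕ → ℕ → ℕ
rowList []       _             = 0
rowList (x ∷ xs) zero          = 0
rowList (x ∷ xs) (suc zero)    = x
rowList (x ∷ xs) (suc (suc i)) = rowList xs (suc i)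

rowLen : Partition → ℕ → ℕ
rowLen p i = rowList (parts p) i

-- Squares are (row , column), both 1-indexed (English convention).
Square : Set
Square = ℕ × ℕ

rowOf : Square → ℕ
rowOf = proj₁

colOf : Square → ℕ
colOf = proj₂

_∈ᴰ_ : Square → Partition → Set
(i , j) ∈ᴰ p = (1 ≤ i) × (1 ≤ j) × (j ≤ rowLen p i)

_⊆ᴰ_ : Partition → Partition → Set
ν ⊆ᴰ l = ∀ s → s ∈ᴰ ν → s ∈ᴰ l

InSkew : Partition → Partition → Square → Set
InSkew l ν s = s ∈ᴰ l × ¬ (s ∈ᴰ ν)

HorizontalStrip : Partition → Partition → Set
HorizontalStrip l ν =
  (ν ⊆ᴰ l) × (∀ s t → InSkew l ν s → InSkew l ν t → colOf s ≡ colOf t → s ≡ t)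

VerticalStrip : Partition → Partition → Set
VerticalStrip l ν =
  (ν ⊆ᴰ l) × (∀ s t → InSkew l ν s → InSkew l ν t → rowOf s ≡ rowOf t → s ≡ t)

InR : Partition → Partition → Partition → Set
InR l μ ν = VerticalStrip l ν × HorizontalStrip μ ν

RowEnd : Partition → Square → Set
RowEnd p (i , j) = ((i , j) ∈ᴰ p) × ¬ ((i , suc j) ∈ᴰ p)

ColEnd : Partition → Square → Set
ColEnd p (i , j) = ((i , j) ∈ᴰ p) × ¬ ((suc i , j) ∈ᴰ p)

Ambiguous : Partition → Partition → Square → Set
Ambiguous l μ s = s ∈ᴰ l × s ∈ᴰ μ × RowEnd l s × ColEnd μ s

Survivor : Partition → Partition → Set
Survivor l μ = (Σ Partition λ ν → InR l μ ν) × (∀ s → ¬ Ambiguous l μ s)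

module Submission where

open import Defs
open import Data.Nat using (ℕ; _≤_; _≥_; _∸_; zero; suc; z≤n; s≤s; _≤?_)
open import Data.Nat.Properties using (≤-refl; ≤-trans; n≤1+n; 1+n≰n)
open import Data.List using ([]; _∷_)
open import Data.List.Relation.Unary.Linked using (Linked; _∷_; tail)
open import Data.Product using (_×_; _,_; Σ)
open import Relation.Nullary using (¬_; yes; no)

-- In (a) the end of row i−1 of λ lies in column λ_{i−1} ≥ λ_i, so if it were in μ
-- it would also end its column of μ (the square below it, in row i, would put the
-- end of row i of λ into μ). In (b) let row k be the bottom of column i−1 of μ; it
-- lies below row j, so λ_k ≤ λ_j < i, and if that square were in λ it would end its
-- row of λ. Either way we would get a λ-ambiguous
-- square of μ.

rowList-head-≥ : ∀ {x xs} → Linked _≥_ (x ∷ xs) → rowList xs 1 ≤ x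
rowList-head-≥ {xs = []}    _           = z≤n
rowList-head-≥ {xs = _ ∷ _} (y≤x ∷ _)   = y≤x

rowList-antitone : ∀ {xs} → Linked _≥_ xs → ∀ {i j} → i ≤ j →
                   rowList xs (suc j) ≤ rowList xs (suc i)
rowList-antitone {[]}    _   _         = z≤n
rowList-antitone {_ ∷ _} _   {zero} {zero}  _ = ≤-refl
rowList-antitone {_ ∷ _} dec {zero} {suc j} _ =
  ≤-trans (rowList-antitone (tail dec) {0} {j} z≤n) (rowList-head-≥ dec)
rowList-antitone {_ ∷ _} dec {suc i} {suc j} (s≤s i≤j) =
  rowList-antitone (tail dec) i≤j

rowLen-antitone : ∀ p {i j} → 1 ≤ i → i ≤ j → rowLen p j ≤ rowLen p i
rowLen-antitone p {suc i} {suc j} _ (s≤s i≤j) = rowList-antitone (decreasing p) i≤j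

-- Rows are counted from 1, so suc r is the starting row and suc k the last row
-- from there on of length ≥ c.
rowList-lastRow≥ : ∀ xs {r c} → 1 ≤ c → c ≤ rowList xs (suc r) →
  Σ ℕ λ k → r ≤ k × c ≤ rowList xs (suc k) × ¬ (c ≤ rowList xs (suc (suc k)))
rowList-lastRow≥ []       (s≤s _) ()
rowList-lastRow≥ (x ∷ xs) {zero}  {c} 1≤c c≤x with c ≤? rowList xs 1
... | no  c≰next = zero , z≤n , c≤x , c≰next
... | yes c≤next with rowList-lastRow≥ xs {zero} 1≤c c≤next
...   | k , _ , c≤k , c≰k+1 = suc k , z≤n , c≤k , c≰k+1
rowList-lastRow≥ (x ∷ xs) {suc r} 1≤c c≤row with rowList-lastRow≥ xs {r} 1≤c c≤row
... | k , r≤k , c≤k , c≰k+1 = suc k , s≤s r≤k , c≤k , c≰k+1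

colEnd-below : ∀ p {r c} → (r , c) ∈ᴰ p → Σ ℕ λ k → r ≤ k × ColEnd p (k , c)
colEnd-below p {suc r} (_ , 1≤c , c≤row) with rowList-lastRow≥ (parts p) {r} 1≤c c≤row
... | k , r≤k , c≤k , c≰k+1 =
  suc k , s≤s r≤k , (s≤s z≤n , 1≤c , c≤k) , λ { (_ , _ , c≤k+1) → c≰k+1 c≤k+1 }

∈ᴰ-left : ∀ p {i j j′} → 1 ≤ j′ → j′ ≤ j → (i , j) ∈ᴰ p → (i , j′) ∈ᴰ p
∈ᴰ-left _ 1≤j′ j′≤j (1≤i , _ , j≤row) = 1≤i , 1≤j′ , ≤-trans j′≤j j≤row

rowEnd-rowLen : ∀ p {i} → 1 ≤ i → 1 ≤ rowLen p i → RowEnd p (i , rowLen p i)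
rowEnd-rowLen p 1≤i 1≤row = (1≤i , 1≤row , ≤-refl) , λ { (_ , _ , h) → 1+n≰n h }

survivor-rowEnd⇒¬colEnd : ∀ {l μ} → Survivor l μ → ∀ {s} → RowEnd l s → ¬ ColEnd μ s
survivor-rowEnd⇒¬colEnd (_ , noAmbiguous) {s} end@(s∈l , _) colEnd@(s∈μ , _) =
  noAmbiguous s (s∈l , s∈μ , end , colEnd)

proposition3p3 : (l μ : Partition) → Survivor l μ →
    ((i j : ℕ) → 2 ≤ i → RowEnd l (i , j) → ¬ ((i , j) ∈ᴰ μ) →
      Σ ℕ (λ k → RowEnd l (i ∸ 1 , k) × ¬ ((i ∸ 1 , k) ∈ᴰ μ)))
    × ((i j : ℕ) → 2 ≤ i → ColEnd μ (j , i) → ¬ ((j , i) ∈ᴰ l) →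
      Σ ℕ (λ k → ColEnd μ (k , i ∸ 1) × ¬ ((k , i ∸ 1) ∈ᴰ l)))
proposition3p3 l μ survivor = rowEnds , colEnds
  where
  notBoth : ∀ {s} → RowEnd l s → ¬ ColEnd μ s
  notBoth = survivor-rowEnd⇒¬colEnd {l} {μ} survivor

  rowEnds : (i j : ℕ) → 2 ≤ i → RowEnd l (i , j) → ¬ ((i , j) ∈ᴰ μ) →
    Σ ℕ (λ k → RowEnd l (i ∸ 1 , k) × ¬ ((i ∸ 1 , k) ∈ᴰ μ))
  rowEnds (suc (suc m)) j (s≤s (s≤s _)) ((_ , 1≤j , j≤λᵢ) , _) end∉μ =
    L , end , λ above∈μ → notBoth end (above∈μ , below∉μ)
    where
    L : ℕ
    L = rowLen l (suc m)
    j≤L : j ≤ L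
    j≤L = ≤-trans j≤λᵢ (rowLen-antitone l (s≤s z≤n) (n≤1+n (suc m)))
    end : RowEnd l (suc m , L)
    end = rowEnd-rowLen l (s≤s z≤n) (≤-trans 1≤j j≤L)
    below∉μ : ¬ ((suc (suc m) , L) ∈ᴰ μ)
    below∉μ below∈μ = end∉μ (∈ᴰ-left μ 1≤j j≤L below∈μ)

  colEnds : (i j : ℕ) → 2 ≤ i → ColEnd μ (j , i) → ¬ ((j , i) ∈ᴰ l) →
    Σ ℕ (λ k → ColEnd μ (k , i ∸ 1) × ¬ ((k , i ∸ 1) ∈ᴰ l))
  colEnds (suc (suc m)) j (s≤s (s≤s _)) (end∈μ@(1≤j , 1≤i , _) , _) end∉l
    with colEnd-below μ (∈ᴰ-left μ (s≤s z≤n) (n≤1+n (suc m)) end∈μ)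
  ... | k , j≤k , bottom =
    k , bottom , λ bottom∈l → notBoth
      (bottom∈l , λ { (_ , _ , i≤λₖ) → end∉l (1≤j , 1≤i , ≤-trans i≤λₖ λₖ≤λⱼ) }) bottom
    where
    λₖ≤λⱼ : rowLen l k ≤ rowLen l j
    λₖ≤λⱼ = rowLen-antitone l 1≤j j≤k
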